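{- Let $q$ be a prime power, $0<k<n$ and $0\le t\le k$ integers. If the graph $\Delta_t(n,k-1)$ is not connected, then the graph $\widetilde{\Lambda}_t(n,k)$ is not connected.
   Context: Let $V=\mathbb{F}_q^n$. An $[n,m]$-linear code is an $m$-dimensional subspace of $V$; $\mathcal{C}_t(n,m)$ denotes the set of $[n,m]$-codes such that any $t$ columns of a generator matrix (an $m\times n$ matrix whose rows form a basis) are linearly independent. $\Delta_t(n,m)$ is the graph on $\mathcal{C}_t(n,m)$ with $X\sim Y$ iff $\dim(X\cap Y)=m-1$. $\Lambda_t(n,k)$ is the graph on $\mathcal{C}_t(n,k)$ with $X\sim Y$ iff $X\cap Y\in\mathcal{C}_t(n,k-1)$. A code $C\in\mathcal{C}_t(n,k)$ is isolated if it contains no subspace in $\mathcal{C}_t(n,k-1)$; $\widetilde{\Lambda}_t(n,k)$ is the subgraph of $\Lambda_t(n,k)$ induced on the non-isolated codes. The empty graph is considered connected. -}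

module Defs where

open import Level using (Level; _⊔_) renaming (suc to lsuc)
open import Data.Nat using (ℕ; zero; suc; _^_)
open import Data.Nat.Primality using (Prime)
open import Data.Fin using (Fin; zero; suc)
open import Data.Product using (Σ; Σ-syntax; ∃; _×_; _,_)
open import Data.Sum using (_⊎_)
open import Relation.Nullary using (¬_)
open import Relation.Binary.PropositionalEquality using (_≡_)
open import Relation.Binary.Construct.Closure.ReflexiveTransitive using (Star)
open import Algebra.Bundles using (CommutativeRing)

record FiniteField (c ℓ : Level) : Set (lsuc (c ⊔ ℓ)) where
  field
    commRing   : CommutativeRing c ℓ
  open CommutativeRing commRing public
  field
    0≉1        : ¬ (0# ≈ 1#)
    inverse    : ∀ x → ¬ (x ≈ 0#) → Σ Carrier λ y → (x * y) ≈ 1#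
    q          : ℕ
    q-primePow : Σ ℕ λ p → Σ ℕ λ e → Prime p × (q ≡ p ^ suc e)
    enum       : Fin q → Carrier
    enum-surj  : ∀ x → Σ (Fin q) λ i → enum i ≈ x
    enum-inj   : ∀ i j → enum i ≈ enum j → i ≡ j

module Codes {c ℓ : Level} (F : FiniteField c ℓ) where
  open FiniteField F using (Carrier; _≈_; _+_; _*_; 0#)

  Σᶠ : {m : ℕ} → (Fin m → Carrier) → Carrier
  Σᶠ {zero}  f = 0#
  Σᶠ {suc m} f = f zero + Σᶠ (λ i → f (suc i))

  Vec : ℕ → Set c
  Vec n = Fin n → Carrier

  Mat : ℕ → ℕ → Set c
  Mat m n = Fin m → Fin n → Carrier

  _≈ᵥ_ : {n : ℕ} → Vec n → Vec n → Set ℓ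
  u ≈ᵥ v = ∀ j → u j ≈ v j

  comb : {m n : ℕ} → (Fin m → Carrier) → Mat m n → Vec n
  comb a G j = Σᶠ (λ i → a i * G i j)

  RowIndep : {m n : ℕ} → Mat m n → Set (c ⊔ ℓ)
  RowIndep {m} G = (a : Fin m → Carrier) → comb a G ≈ᵥ (λ _ → 0#) → ∀ i → a i ≈ 0#

  _∈span_ : {m n : ℕ} → Vec n → Mat m n → Set (c ⊔ ℓ)
  _∈span_ {m} v G = Σ (Fin m → Carrier) λ a → comb a G ≈ᵥ v

  SameCode : {m n : ℕ} → Mat m n → Mat m n → Set (c ⊔ ℓ)
  SameCode {n = n} X Y = (v : Vec n) → (v ∈span X → v ∈span Y) × (v ∈span Y → v ∈span X)

  _⊆span_ : {r m n : ℕ} → Mat r n → Mat m n → Set (c ⊔ ℓ)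
  _⊆span_ {n = n} H G = (v : Vec n) → v ∈span H → v ∈span G

  SpanIsMeet : {r m n : ℕ} → Mat r n → Mat m n → Mat m n → Set (c ⊔ ℓ)
  SpanIsMeet {n = n} H X Y =
    (v : Vec n) → (v ∈span H → (v ∈span X × v ∈span Y))
                × ((v ∈span X × v ∈span Y) → v ∈span H)

  -- any t columns of G are linearly independent: for every injective choice
  -- s of t column indices, the columns G(-, s j) are linearly independent in F^m
  TCols : {m n : ℕ} → ℕ → Mat m n → Set (c ⊔ ℓ)
  TCols {m} {n} t G =
    (s : Fin t → Fin n) → (∀ i j → s i ≡ s j → i ≡ j) →
    (d : Fin t → Carrier) → (∀ i → Σᶠ (λ j → d j * G i (s j)) ≈ 0#) →
    ∀ j → d j ≈ 0#

  InC : (t n m : ℕ) → Mat m n → Set (c ⊔ ℓ)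
  InC t n m G = RowIndep G × TCols t G

  -- adjacency in Δ_t(n,m): dim (X ∩ Y) = m - 1
  AdjΔ : {m n : ℕ} → Mat m n → Mat m n → Set (c ⊔ ℓ)
  AdjΔ {m} {n} X Y =
    Σ ℕ λ r → (suc r ≡ m) × Σ (Mat r n) λ H → RowIndep H × SpanIsMeet H X Y

  -- adjacency in Λ_t(n,k): X ∩ Y ∈ C_t(n,k-1)
  AdjΛ : (t : ℕ) → {k n : ℕ} → Mat k n → Mat k n → Set (c ⊔ ℓ)
  AdjΛ t {k} {n} X Y =
    Σ ℕ λ r → (suc r ≡ k) × Σ (Mat r n) λ H → InC t n r H × SpanIsMeet H X Y

  -- X ∈ C_t(n,k) is non-isolated: it contains some subspace in C_t(n,k-1)
  NonIsolated : (t n k : ℕ) → Mat k n → Set (c ⊔ ℓ)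
  NonIsolated t n k X =
    Σ ℕ λ r → (suc r ≡ k) × Σ (Mat r n) λ H → InC t n r H × H ⊆span X

  -- Codes are represented
  -- by generator matrices; steps between two generator matrices of the same
  -- code are allowed (this is the identity on the code level).
  -- The empty graph is connected (vacuously).
  Step : {m n : ℕ} → (Mat m n → Set (c ⊔ ℓ)) →
         (Mat m n → Mat m n → Set (c ⊔ ℓ)) → Mat m n → Mat m n → Set (c ⊔ ℓ)
  Step V Adj X Y = V X × V Y × (Adj X Y ⊎ SameCode X Y)

  Connected : {m n : ℕ} → (Mat m n → Set (c ⊔ ℓ)) →
              (Mat m n → Mat m n → Set (c ⊔ ℓ)) → Set (c ⊔ ℓ)
  Connected V Adj = ∀ X Y → V X → V Y → Star (Step V Adj) X Y

  ΔConnected : (t n m : ℕ) → Set (c ⊔ ℓ)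
  ΔConnected t n m = Connected {m} {n} (InC t n m) AdjΔ

  ΛtildeConnected : (t n k : ℕ) → Set (c ⊔ ℓ)
  ΛtildeConnected t n k =
    Connected {k} {n} (λ X → InC t n k X × NonIsolated t n k X) (AdjΛ t)

module Submission where

-- Contrapositive: a path in Λ̃_t(n,k) is turned into one in Δ_t(n,k-1).  A code
-- A ∈ C_t(n,k-1) extends to a k-dimensional X ⊇ A by adding a vector outside A;
-- adding a row keeps any t columns independent, and X is non-isolated since it
-- contains A.  Along a path X = X₀ ∼ X₁ ∼ … ∼ Xₗ = Y in Λ̃ the intersections
-- Hᵢ = Xᵢ₋₁ ∩ Xᵢ lie in C_t(n,k-1), and any two (k-1)-dimensional subspaces of one
-- k-dimensional code coincide or meet in dimension k-2.  Hence A, H₁, …, Hₗ, B is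
-- a path in Δ_t(n,k-1) whenever B ⊆ Y.  Over a finite field membership in a span is
-- decidable, which makes the dimension arguments constructive.

open import Defs
open import Level using (Level; _⊔_)
open import Function.Base using (_∘_)
open import Data.Nat using (ℕ; zero; suc; _<_; _≤_; _∸_; z≤n; s≤s)
open import Data.Nat.Properties using (m≤n⇒m≤1+n; <⇒≤; <⇒≱; n≮n; suc-injective)
open import Data.Fin as Fin using (Fin; zero; suc; punchIn; punchOut)
open import Data.Fin.Properties using (any?; all?; punchInᵢ≢i; punchIn-punchOut)
open import Data.Vec.Functional using (tail; removeAt; insertAt) renaming (_∷_ to _∷ᶠ_)
open import Data.Vec.Functional.Properties using (insertAt-lookup; insertAt-punchIn)
open import Data.Product using (Σ; ∃; _×_; _,_; proj₁; proj₂)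
open import Data.Sum using (_⊎_; inj₁; inj₂)
open import Data.Empty using (⊥-elim)
open import Relation.Nullary using (¬_; Dec; yes; no)
open import Relation.Nullary.Decidable using (¬?; decidable-stable; map′)
open import Relation.Binary.PropositionalEquality as ≡ using (_≡_; _≢_)
open import Relation.Binary.Construct.Closure.ReflexiveTransitive using (Star; ε; _◅_)

module Subspaces {c ℓ : Level} (F : FiniteField c ℓ) where
  open FiniteField F hiding (zero)
  open Codes F
  open import Relation.Binary.Reasoning.Setoid setoid
  open import Algebra.Properties.Ring ring using (-‿distribˡ-*; -‿distribʳ-*; -1*x≈-x)
  open import Algebra.Properties.Group +-group using (ε⁻¹≈ε; ⁻¹-involutive)
  open import Algebra.Properties.Semiring.Sum semiring
    using (sum; sum-cong-≋; sum-replicate-zero; sum-remove; ∑-distrib-+; *-distribˡ-sum)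

  private variable
    m n p r : ℕ
    x : Carrier
    u v g b : Vec n

  _≟_ : (x y : Carrier) → Dec (x ≈ y)
  x ≟ y with enum-surj x | enum-surj y
  ... | i , eᵢ≈x | j , eⱼ≈y =
    map′ (λ { ≡.refl → trans (sym eᵢ≈x) eⱼ≈y })
         (λ x≈y → enum-inj i j (trans eᵢ≈x (trans x≈y (sym eⱼ≈y))))
         (i Fin.≟ j)

  Σᶠ≡sum : (f : Fin m → Carrier) → Σᶠ f ≡ sum f
  Σᶠ≡sum {zero}  f = ≡.refl
  Σᶠ≡sum {suc m} f = ≡.cong (f zero +_) (Σᶠ≡sum (f ∘ suc))

  Σᶠ-cong : {f h : Fin m → Carrier} → (∀ i → f i ≈ h i) → Σᶠ f ≈ Σᶠ h
  Σᶠ-cong {f = f} {h} f≈h = begin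
    Σᶠ f  ≡⟨ Σᶠ≡sum f ⟩
    sum f ≈⟨ sum-cong-≋ f≈h ⟩
    sum h ≡⟨ Σᶠ≡sum h ⟨
    Σᶠ h  ∎

  Σᶠ-zero : {f : Fin m → Carrier} → (∀ i → f i ≈ 0#) → Σᶠ f ≈ 0#
  Σᶠ-zero {m} {f} f≈0 = begin
    Σᶠ f                ≈⟨ Σᶠ-cong f≈0 ⟩
    Σᶠ {m} (λ _ → 0#)   ≡⟨ Σᶠ≡sum {m} (λ _ → 0#) ⟩
    sum {m} (λ _ → 0#)  ≈⟨ sum-replicate-zero m ⟩
    0#                  ∎

  Σᶠ-+ : (f h : Fin m → Carrier) → Σᶠ (λ i → f i + h i) ≈ Σᶠ f + Σᶠ h
  Σᶠ-+ f h = begin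
    Σᶠ (λ i → f i + h i)  ≡⟨ Σᶠ≡sum (λ i → f i + h i) ⟩
    sum (λ i → f i + h i) ≈⟨ ∑-distrib-+ f h ⟩
    sum f + sum h         ≡⟨ ≡.cong₂ _+_ (Σᶠ≡sum f) (Σᶠ≡sum h) ⟨
    Σᶠ f + Σᶠ h           ∎

  *-distribˡ-Σᶠ : ∀ x (f : Fin m → Carrier) → x * Σᶠ f ≈ Σᶠ (λ i → x * f i)
  *-distribˡ-Σᶠ x f = begin
    x * Σᶠ f             ≡⟨ ≡.cong (x *_) (Σᶠ≡sum f) ⟩
    x * sum f            ≈⟨ *-distribˡ-sum x f ⟩
    sum (λ i → x * f i)  ≡⟨ Σᶠ≡sum (λ i → x * f i) ⟨
    Σᶠ (λ i → x * f i)   ∎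

  Σᶠ-remove : (f : Fin (suc m) → Carrier) (i : Fin (suc m)) → Σᶠ f ≈ f i + Σᶠ (removeAt f i)
  Σᶠ-remove f i = begin
    Σᶠ f                      ≡⟨ Σᶠ≡sum f ⟩
    sum f                     ≈⟨ sum-remove {i = i} f ⟩
    f i + sum (removeAt f i)  ≡⟨ ≡.cong (f i +_) (Σᶠ≡sum (removeAt f i)) ⟨
    f i + Σᶠ (removeAt f i)   ∎

  Σᶠ-single : (f : Fin m → Carrier) (i : Fin m) → (∀ j → j ≢ i → f j ≈ 0#) → Σᶠ f ≈ f i
  Σᶠ-single {suc m} f i f≈0 = begin
    Σᶠ f                    ≈⟨ Σᶠ-remove f i ⟩
    f i + Σᶠ (removeAt f i) ≈⟨ +-congˡ (Σᶠ-zero (λ l → f≈0 (punchIn i l) (punchInᵢ≢i i l))) ⟩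
    f i + 0#                ≈⟨ +-identityʳ (f i) ⟩
    f i                     ∎

  infixl 21 _+ᵥ_
  infixr 22 _*ᵥ_

  0ᵥ : Vec n
  0ᵥ _ = 0#

  _+ᵥ_ : Vec n → Vec n → Vec n
  (u +ᵥ v) j = u j + v j

  _*ᵥ_ : Carrier → Vec n → Vec n
  (x *ᵥ v) j = x * v j

  +ᵥ-shift-by-0 : x ≈ 0# → (u +ᵥ (- x) *ᵥ b) ≈ᵥ u
  +ᵥ-shift-by-0 {x = x} {u = u} {b = b} x≈0 j = begin
    u j + (- x) * b j   ≈⟨ +-congˡ (-‿distribˡ-* x (b j)) ⟨
    u j + - (x * b j)   ≈⟨ +-congˡ (-‿cong (trans (*-congʳ x≈0) (zeroˡ (b j)))) ⟩
    u j + - 0#          ≈⟨ +-congˡ ε⁻¹≈ε ⟩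
    u j + 0#            ≈⟨ +-identityʳ (u j) ⟩
    u j                 ∎

  neg-inverse-cancel : ∀ {y} → x * y ≈ 1# → ∀ z → (- y) * ((- x) * z) ≈ z
  neg-inverse-cancel {x} {y} xy≈1 z = begin
    (- y) * ((- x) * z) ≈⟨ *-assoc (- y) (- x) z ⟨
    ((- y) * (- x)) * z ≈⟨ *-congʳ (-‿distribˡ-* y (- x)) ⟨
    - (y * (- x)) * z   ≈⟨ *-congʳ (-‿cong (-‿distribʳ-* y x)) ⟨
    - - (y * x) * z     ≈⟨ *-congʳ (⁻¹-involutive (y * x)) ⟩
    (y * x) * z         ≈⟨ *-congʳ (trans (*-comm y x) xy≈1) ⟩
    1# * z              ≈⟨ *-identityˡ z ⟩
    z                   ∎

  comb-congˡ : {a a′ : Fin m → Carrier} (G : Mat m n) →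
               (∀ i → a i ≈ a′ i) → comb a G ≈ᵥ comb a′ G
  comb-congˡ G a≈a′ j = Σᶠ-cong (λ i → *-congʳ (a≈a′ i))

  comb-+ : (a a′ : Fin m → Carrier) (G : Mat m n) →
           comb (λ i → a i + a′ i) G ≈ᵥ comb a G +ᵥ comb a′ G
  comb-+ a a′ G j = trans (Σᶠ-cong (λ i → distribʳ (G i j) (a i) (a′ i)))
                          (Σᶠ-+ (λ i → a i * G i j) (λ i → a′ i * G i j))

  comb-* : ∀ x (a : Fin m → Carrier) (G : Mat m n) → comb (λ i → x * a i) G ≈ᵥ x *ᵥ comb a G
  comb-* x a G j =
    trans (Σᶠ-cong (λ i → *-assoc x (a i) (G i j))) (sym (*-distribˡ-Σᶠ x (λ i → a i * G i j)))

  comb-removeAt : (a : Fin (suc m) → Carrier) (G : Mat (suc m) n) (i : Fin (suc m)) →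
                  comb a G ≈ᵥ a i *ᵥ G i +ᵥ comb (removeAt a i) (removeAt G i)
  comb-removeAt a G i j = Σᶠ-remove (λ l → a l * G l j) i

  comb-+*ᵥ : (a μ : Fin m → Carrier) (U : Mat m n) (z : Vec n) →
             comb a (λ l → U l +ᵥ μ l *ᵥ z) ≈ᵥ comb a U +ᵥ Σᶠ (λ l → a l * μ l) *ᵥ z
  comb-+*ᵥ a μ U z j = begin
    Σᶠ (λ l → a l * (U l j + μ l * z j))
      ≈⟨ Σᶠ-cong (λ l → distribˡ (a l) _ _) ⟩
    Σᶠ (λ l → a l * U l j + a l * (μ l * z j))
      ≈⟨ Σᶠ-+ (λ l → a l * U l j) (λ l → a l * (μ l * z j)) ⟩
    comb a U j + Σᶠ (λ l → a l * (μ l * z j))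
      ≈⟨ +-congˡ (Σᶠ-cong (λ l → *-assoc (a l) (μ l) (z j))) ⟨
    comb a U j + Σᶠ (λ l → (a l * μ l) * z j)
      ≈⟨ +-congˡ (Σᶠ-cong (λ l → *-comm (a l * μ l) (z j))) ⟩
    comb a U j + Σᶠ (λ l → z j * (a l * μ l))
      ≈⟨ +-congˡ (*-distribˡ-Σᶠ (z j) (λ l → a l * μ l)) ⟨
    comb a U j + z j * Σᶠ (λ l → a l * μ l)
      ≈⟨ +-congˡ (*-comm (z j) _) ⟩
    comb a U j + Σᶠ (λ l → a l * μ l) * z j
      ∎

  comb-∷ : (G : Mat m n) (a : Fin (suc m) → Carrier) →
           comb a (g ∷ᶠ G) ≈ᵥ v → comb (tail a) G ≈ᵥ v +ᵥ (- a zero) *ᵥ g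
  comb-∷ {g = g} {v = v} G a p j = begin
    w                                      ≈⟨ +-identityˡ w ⟨
    0# + w                                 ≈⟨ +-congʳ (-‿inverseˡ (a zero * g j)) ⟨
    (- (a zero * g j) + a zero * g j) + w  ≈⟨ +-assoc _ _ w ⟩
    - (a zero * g j) + (a zero * g j + w)  ≈⟨ +-congˡ (p j) ⟩
    - (a zero * g j) + v j                 ≈⟨ +-comm _ (v j) ⟩
    v j + - (a zero * g j)                 ≈⟨ +-congˡ (-‿distribˡ-* (a zero) (g j)) ⟩
    v j + (- a zero) * g j                 ∎
    where w = comb (tail a) G j

  comb-∷⁻¹ : (G : Mat m n) (a : Fin m → Carrier) →
             comb a G ≈ᵥ v +ᵥ (- x) *ᵥ g → comb (x ∷ᶠ a) (g ∷ᶠ G) ≈ᵥ v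
  comb-∷⁻¹ {v = v} {x = x} {g = g} G a p j = begin
    x * g j + comb a G j             ≈⟨ +-congˡ (p j) ⟩
    x * g j + (v j + (- x) * g j)    ≈⟨ +-congˡ (+-congˡ (-‿distribˡ-* x (g j))) ⟨
    x * g j + (v j + - (x * g j))    ≈⟨ +-congˡ (+-comm (v j) _) ⟩
    x * g j + (- (x * g j) + v j)    ≈⟨ +-assoc _ _ (v j) ⟨
    (x * g j + - (x * g j)) + v j    ≈⟨ +-congʳ (-‿inverseʳ (x * g j)) ⟩
    0# + v j                         ≈⟨ +-identityˡ (v j) ⟩
    v j                              ∎

  basis : Fin n → Vec n
  basis zero    zero    = 1#
  basis zero    (suc j) = 0#
  basis (suc i) zero    = 0#
  basis (suc i) (suc j) = basis i j

  basis-diag : (i : Fin n) → basis i i ≡ 1#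
  basis-diag zero    = ≡.refl
  basis-diag (suc i) = basis-diag i

  basis-off : {i j : Fin n} → i ≢ j → basis i j ≡ 0#
  basis-off {i = zero}  {zero}  0≢0 = ⊥-elim (0≢0 ≡.refl)
  basis-off {i = zero}  {suc j} _   = ≡.refl
  basis-off {i = suc i} {zero}  _   = ≡.refl
  basis-off {i = suc i} {suc j} i≢j = basis-off (i≢j ∘ ≡.cong suc)

  comb-basis : (a : Fin n → Carrier) → comb a basis ≈ᵥ a
  comb-basis a j = begin
    comb a basis j   ≈⟨ Σᶠ-single _ j off-diagonal ⟩
    a j * basis j j  ≈⟨ *-congˡ (reflexive (basis-diag j)) ⟩
    a j * 1#         ≈⟨ *-identityʳ (a j) ⟩
    a j              ∎
    where
    off-diagonal : ∀ l → l ≢ j → a l * basis l j ≈ 0#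
    off-diagonal l l≢j = trans (*-congˡ (reflexive (basis-off l≢j))) (zeroʳ (a l))

  comb-basis-row : (G : Mat m n) (i : Fin m) → comb (basis i) G ≈ᵥ G i
  comb-basis-row G i j = begin
    comb (basis i) G j  ≈⟨ Σᶠ-single _ i off-diagonal ⟩
    basis i i * G i j   ≈⟨ *-congʳ (reflexive (basis-diag i)) ⟩
    1# * G i j          ≈⟨ *-identityˡ (G i j) ⟩
    G i j               ∎
    where
    off-diagonal : ∀ l → l ≢ i → basis i l * G l j ≈ 0#
    off-diagonal l l≢i = trans (*-congʳ (reflexive (basis-off (l≢i ∘ ≡.sym)))) (zeroˡ (G l j))

  basis-RowIndep : RowIndep (basis {n})
  basis-RowIndep a a·basis≈0 i = trans (sym (comb-basis a i)) (a·basis≈0 i)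

  ∈span-resp : {G : Mat m n} → u ≈ᵥ v → u ∈span G → v ∈span G
  ∈span-resp u≈v (a , a·G≈u) = a , λ j → trans (a·G≈u j) (u≈v j)

  0ᵥ∈span : (G : Mat m n) → 0ᵥ ∈span G
  0ᵥ∈span G = (λ _ → 0#) , λ j → Σᶠ-zero (λ i → zeroˡ (G i j))

  +ᵥ-∈span : (G : Mat m n) → u ∈span G → v ∈span G → (u +ᵥ v) ∈span G
  +ᵥ-∈span G (a , a·G≈u) (a′ , a′·G≈v) =
    (λ i → a i + a′ i) , λ j → trans (comb-+ a a′ G j) (+-cong (a·G≈u j) (a′·G≈v j))

  *ᵥ-∈span : (G : Mat m n) → ∀ x → v ∈span G → (x *ᵥ v) ∈span G
  *ᵥ-∈span G x (a , a·G≈v) =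
    (λ i → x * a i) , λ j → trans (comb-* x a G j) (*-congˡ (a·G≈v j))

  row∈span : (G : Mat m n) (i : Fin m) → G i ∈span G
  row∈span G i = basis i , comb-basis-row G i

  rows⊆span : {H : Mat r n} {G : Mat m n} → (∀ i → H i ∈span G) → H ⊆span G
  rows⊆span {r = zero}  {G = G} _      v (a , 0≈v) = ∈span-resp 0≈v (0ᵥ∈span G)
  rows⊆span {r = suc r} {H = H} {G} Hᵢ∈G v (a , a·H≈v) =
    ∈span-resp a·H≈v (+ᵥ-∈span G (*ᵥ-∈span G (a zero) (Hᵢ∈G zero))
                                 (rows⊆span {H = tail H} (Hᵢ∈G ∘ suc) _ (tail a , λ _ → refl)))

  ∈span-∷⁺ : (G : Mat m n) → (v +ᵥ (- x) *ᵥ g) ∈span G → v ∈span (g ∷ᶠ G)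
  ∈span-∷⁺ {x = x} G (a , p) = (x ∷ᶠ a) , comb-∷⁻¹ G a p

  ∈span-∷-head≈0 : (G : Mat m n) (a : Fin (suc m) → Carrier) →
                   comb a (g ∷ᶠ G) ≈ᵥ v → a zero ≈ 0# → v ∈span G
  ∈span-∷-head≈0 {g = g} {v = v} G a p a₀≈0 =
    tail a , λ j → trans (comb-∷ G a p j) (+ᵥ-shift-by-0 {u = v} {b = g} a₀≈0 j)

  -- v ∈ span (g ∷ G) iff v - x g ∈ span G for some x, and there are only q candidates x.
  _∈span?_ : (v : Vec n) (G : Mat m n) → Dec (v ∈span G)
  _∈span?_ {m = zero}  v G = map′ (λ 0≈v → (λ ()) , 0≈v) proj₂ (all? (λ j → 0# ≟ v j))
  _∈span?_ {m = suc m} v G = map′ shifted⇒∈ ∈⇒shifted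
      (any? (λ i → (v +ᵥ (- enum i) *ᵥ G zero) ∈span? tail G))
    where
    shifted⇒∈ : ∃ (λ i → (v +ᵥ (- enum i) *ᵥ G zero) ∈span tail G) → v ∈span G
    shifted⇒∈ (i , shifted∈) = ∈span-∷⁺ (tail G) shifted∈
    ∈⇒shifted : v ∈span G → ∃ (λ i → (v +ᵥ (- enum i) *ᵥ G zero) ∈span tail G)
    ∈⇒shifted (a , a·G≈v) with enum-surj (a zero)
    ... | i , eᵢ≈a₀ = i , ∈span-resp (λ j → +-congˡ (*-congʳ (-‿cong (sym eᵢ≈a₀))))
                                      (tail a , comb-∷ (tail G) a a·G≈v)

  ⊆span⊎∃∉span : (H : Mat r n) (G : Mat m n) → H ⊆span G ⊎ ∃ λ i → ¬ (H i ∈span G)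
  ⊆span⊎∃∉span H G with any? (λ i → ¬? (H i ∈span? G))
  ... | yes ∃Hᵢ∉G = inj₂ ∃Hᵢ∉G
  ... | no ¬∃Hᵢ∉G = inj₁ (rows⊆span {H = H} {G = G} λ i →
    decidable-stable (H i ∈span? G) (λ Hᵢ∉G → ¬∃Hᵢ∉G (i , Hᵢ∉G)))

  shift∈span⇒≈0 : {G : Mat m n} → ¬ (b ∈span G) →
                  u ∈span G → (u +ᵥ (- x) *ᵥ b) ∈span G → x ≈ 0#
  shift∈span⇒≈0 {b = b} {u = u} {x = x} {G = G} b∉G u∈G shifted∈G =
    decidable-stable (x ≟ 0#) λ x≉0 →
    let y , xy≈1 = inverse x x≉0 in
    b∉G (∈span-resp (λ j → neg-inverse-cancel xy≈1 (b j))
          (*ᵥ-∈span G (- y) (∈span-resp (λ j → [u+w]-u≈w (u j) _)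
                                        (+ᵥ-∈span G shifted∈G (*ᵥ-∈span G (- 1#) u∈G)))))
    where
    [u+w]-u≈w : ∀ u w → (u + w) + (- 1#) * u ≈ w
    [u+w]-u≈w u w = begin
      (u + w) + (- 1#) * u ≈⟨ +-cong (+-comm u w) (-1*x≈-x u) ⟩
      (w + u) + - u        ≈⟨ +-assoc w u (- u) ⟩
      w + (u + - u)        ≈⟨ +-congˡ (-‿inverseʳ u) ⟩
      w + 0#               ≈⟨ +-identityʳ w ⟩
      w                    ∎

  ∷-RowIndep : {G : Mat m n} → RowIndep G → ¬ (v ∈span G) → RowIndep (v ∷ᶠ G)
  ∷-RowIndep {v = v} {G = G} G-indep v∉G a a·[v∷G]≈0 = λ where
      zero    → a₀≈0
      (suc i) → G-indep (tail a) tail-comb≈0 i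
    where
    tail-comb : comb (tail a) G ≈ᵥ 0ᵥ +ᵥ (- a zero) *ᵥ v
    tail-comb = comb-∷ G a a·[v∷G]≈0
    a₀≈0 : a zero ≈ 0#
    a₀≈0 = shift∈span⇒≈0 v∉G (0ᵥ∈span G) (tail a , tail-comb)
    tail-comb≈0 : comb (tail a) G ≈ᵥ 0ᵥ
    tail-comb≈0 j = trans (tail-comb j) (+ᵥ-shift-by-0 {u = 0ᵥ} {b = v} a₀≈0 j)

  exchange : (G : Mat m n) → v ∈span (g ∷ᶠ G) → ¬ (v ∈span G) → g ∈span (v ∷ᶠ G)
  exchange {v = v} {g = g} G (a , a·[g∷G]≈v) v∉G =
    ∈span-∷⁺ G (∈span-resp solve-for-g (*ᵥ-∈span G (- y) (tail a , comb-∷ G a a·[g∷G]≈v)))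
    where
    a₀≉0 : ¬ (a zero ≈ 0#)
    a₀≉0 = v∉G ∘ ∈span-∷-head≈0 G a a·[g∷G]≈v
    y : Carrier
    y = proj₁ (inverse (a zero) a₀≉0)
    a₀y≈1 : a zero * y ≈ 1#
    a₀y≈1 = proj₂ (inverse (a zero) a₀≉0)
    solve-for-g : (- y) *ᵥ (v +ᵥ (- a zero) *ᵥ g) ≈ᵥ g +ᵥ (- y) *ᵥ v
    solve-for-g j = begin
      (- y) * (v j + (- a zero) * g j)          ≈⟨ distribˡ (- y) (v j) _ ⟩
      (- y) * v j + (- y) * ((- a zero) * g j)  ≈⟨ +-congˡ (neg-inverse-cancel a₀y≈1 (g j)) ⟩
      (- y) * v j + g j                         ≈⟨ +-comm _ (g j) ⟩
      g j + (- y) * v j                         ∎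

  eliminate : Mat (suc m) n → Fin (suc m) → (Fin m → Carrier) → Mat m n
  eliminate M i κ l = M (punchIn i l) +ᵥ (- κ l) *ᵥ M i

  -- A vanishing combination γ of the rows of eliminate M i κ is the combination
  -- insertAt γ i μ of the rows of M.
  eliminate-RowIndep : (M : Mat (suc m) n) (i : Fin (suc m)) (κ : Fin m → Carrier) →
                       RowIndep M → RowIndep (eliminate M i κ)
  eliminate-RowIndep {m = m} M i κ M-indep γ γ·E≈0 l = begin
    γ l              ≡⟨ insertAt-punchIn γ i μ l ⟨
    α (punchIn i l)  ≈⟨ M-indep α α·M≈0 (punchIn i l) ⟩
    0#               ∎
    where
    μ : Carrier
    μ = Σᶠ (λ l → γ l * - κ l)
    α : Fin (suc m) → Carrier
    α = insertAt γ i μ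
    α·M≈0 : comb α M ≈ᵥ 0ᵥ
    α·M≈0 j = begin
      comb α M j                                          ≈⟨ comb-removeAt α M i j ⟩
      α i * M i j + comb (removeAt α i) (removeAt M i) j
        ≈⟨ +-cong (*-congʳ (reflexive (insertAt-lookup γ i μ)))
                  (comb-congˡ (removeAt M i) (λ l → reflexive (insertAt-punchIn γ i μ l)) j) ⟩
      μ * M i j + comb γ (removeAt M i) j                 ≈⟨ +-comm _ _ ⟩
      comb γ (removeAt M i) j + μ * M i j
        ≈⟨ comb-+*ᵥ γ (λ l → - κ l) (removeAt M i) (M i) j ⟨
      comb γ (eliminate M i κ) j                          ≈⟨ γ·E≈0 j ⟩
      0#                                                  ∎

  eliminate-⊆span : (M : Mat (suc m) n) (i : Fin (suc m)) (κ : Fin m → Carrier) →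
                    eliminate M i κ ⊆span M
  eliminate-⊆span M i κ = rows⊆span {G = M} λ l →
    +ᵥ-∈span M (row∈span M (punchIn i l)) (*ᵥ-∈span M (- κ l) (row∈span M i))

  ⊆span-∷-eliminate : (M : Mat (suc m) n) (i : Fin (suc m)) (κ : Fin m → Carrier) →
                      M ⊆span (M i ∷ᶠ eliminate M i κ)
  ⊆span-∷-eliminate {m = m} {n = n} M i κ = rows⊆span {G = M i ∷ᶠ E} row∈
    where
    E : Mat m n
    E = eliminate M i κ
    row∈ : ∀ k → M k ∈span (M i ∷ᶠ E)
    row∈ k with i Fin.≟ k
    ... | yes ≡.refl = row∈span (M i ∷ᶠ E) zero
    ... | no i≢k = ≡.subst (λ k → M k ∈span (M i ∷ᶠ E)) (punchIn-punchOut i≢k)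
                           (∈span-∷⁺ {x = κ (punchOut i≢k)} E (row∈span E (punchOut i≢k)))

  eliminate-⊆span-∷ : {A : Mat r n} (M : Mat (suc m) n) (i : Fin (suc m)) →
                      (M⊆ : ∀ l → M (punchIn i l) ∈span (M i ∷ᶠ A)) →
                      eliminate M i (λ l → proj₁ (M⊆ l) zero) ⊆span A
  eliminate-⊆span-∷ {A = A} M i M⊆ =
    rows⊆span {G = A} λ l → tail (proj₁ (M⊆ l)) , comb-∷ A (proj₁ (M⊆ l)) (proj₂ (M⊆ l))

  -- Steinitz exchange: a row Aᵢ outside span (tail B) may replace B zero, and eliminating
  -- Aᵢ from the other rows of A leaves p independent rows inside span (tail B).
  RowIndep-⊆span⇒≤ : (A : Mat p n) (B : Mat m n) → RowIndep A → A ⊆span B → p ≤ m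
  RowIndep-⊆span⇒≤ {p = zero} A B _ _ = z≤n
  RowIndep-⊆span⇒≤ {p = suc p} {m = zero} A B A-indep A⊆B = ⊥-elim (0≉1 (sym 1≈0))
    where
    A₀≈0 : A zero ≈ᵥ 0ᵥ
    A₀≈0 j = sym (proj₂ (A⊆B (A zero) (row∈span A zero)) j)
    1≈0 : 1# ≈ 0#
    1≈0 = A-indep (basis zero) (λ j → trans (comb-basis-row A zero j) (A₀≈0 j)) zero
  RowIndep-⊆span⇒≤ {p = suc p} {m = suc m} A B A-indep A⊆B with ⊆span⊎∃∉span A (tail B)
  ... | inj₁ A⊆B′ = m≤n⇒m≤1+n (RowIndep-⊆span⇒≤ A (tail B) A-indep A⊆B′)
  ... | inj₂ (i , Aᵢ∉B′) =
    s≤s (RowIndep-⊆span⇒≤ (eliminate A i κ) (tail B) (eliminate-RowIndep A i κ A-indep)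
                          (eliminate-⊆span-∷ A i A⊆Aᵢ∷B′))
    where
    B₀∈ : B zero ∈span (A i ∷ᶠ tail B)
    B₀∈ = exchange (tail B) (A⊆B (A i) (row∈span A i)) Aᵢ∉B′
    B⊆Aᵢ∷B′ : B ⊆span (A i ∷ᶠ tail B)
    B⊆Aᵢ∷B′ = rows⊆span {H = B} {G = A i ∷ᶠ tail B}
                λ { zero → B₀∈ ; (suc k) → row∈span (A i ∷ᶠ tail B) (suc k) }
    A⊆Aᵢ∷B′ : ∀ l → A (punchIn i l) ∈span (A i ∷ᶠ tail B)
    A⊆Aᵢ∷B′ l = B⊆Aᵢ∷B′ _ (A⊆B _ (row∈span A (punchIn i l)))
    κ : Fin p → Carrier
    κ l = proj₁ (A⊆Aᵢ∷B′ l) zero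

  RowIndep-⊆span⇒⊇span : (A B : Mat m n) → RowIndep B → B ⊆span A → A ⊆span B
  RowIndep-⊆span⇒⊇span {m = m} A B B-indep B⊆A = rows⊆span {G = B} λ i →
    decidable-stable (A i ∈span? B) λ Aᵢ∉B →
      n≮n m (RowIndep-⊆span⇒≤ (A i ∷ᶠ B) A (∷-RowIndep B-indep Aᵢ∉B)
               (rows⊆span {H = A i ∷ᶠ B} {G = A}
                  λ { zero → row∈span A i ; (suc k) → B⊆A _ (row∈span B k) }))

  ∃-∉span : (G : Mat m n) → RowIndep G → m < n → ∃ λ v → ¬ (v ∈span G)
  ∃-∉span G G-indep m<n with ⊆span⊎∃∉span basis G
  ... | inj₁ basis⊆G = ⊥-elim (<⇒≱ m<n (RowIndep-⊆span⇒≤ basis G basis-RowIndep basis⊆G))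
  ... | inj₂ (j , basisⱼ∉G) = basis j , basisⱼ∉G

  ∈span-∷-∩ : {A : Mat m n} {H : Mat r n} → ¬ (b ∈span A) → H ⊆span A →
              v ∈span A → v ∈span (b ∷ᶠ H) → v ∈span H
  ∈span-∷-∩ {A = A} {H} b∉A H⊆A v∈A (a , a·[b∷H]≈v) = ∈span-∷-head≈0 H a a·[b∷H]≈v a₀≈0
    where
    a₀≈0 : a zero ≈ 0#
    a₀≈0 = shift∈span⇒≈0 b∉A v∈A (H⊆A _ (tail a , comb-∷ H a a·[b∷H]≈v))

  -- As B j ∉ A, X = span (B j ∷ A), so eliminating B j from the other rows of B
  -- lands in A and gives a basis of A ∩ B.
  distinct-hyperplanes-adjacent :
    (X : Mat (suc (suc r)) n) (A B : Mat (suc r) n) → RowIndep A → RowIndep B →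
    A ⊆span X → B ⊆span X → (j : Fin (suc r)) → ¬ (B j ∈span A) → AdjΔ A B
  distinct-hyperplanes-adjacent {r = r} {n = n} X A B A-indep B-indep A⊆X B⊆X j Bⱼ∉A =
    r , ≡.refl , H , eliminate-RowIndep B j β B-indep , H-meet
    where
    X⊆Bⱼ∷A : X ⊆span (B j ∷ᶠ A)
    X⊆Bⱼ∷A = RowIndep-⊆span⇒⊇span X (B j ∷ᶠ A) (∷-RowIndep {G = A} A-indep Bⱼ∉A)
      (rows⊆span {H = B j ∷ᶠ A} {G = X}
         λ { zero → B⊆X _ (row∈span B j) ; (suc i) → A⊆X _ (row∈span A i) })
    B⊆Bⱼ∷A : ∀ l → B (punchIn j l) ∈span (B j ∷ᶠ A)
    B⊆Bⱼ∷A l = X⊆Bⱼ∷A _ (B⊆X _ (row∈span B (punchIn j l)))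
    β : Fin r → Carrier
    β l = proj₁ (B⊆Bⱼ∷A l) zero
    H : Mat r n
    H = eliminate B j β
    H⊆A : H ⊆span A
    H⊆A = eliminate-⊆span-∷ {A = A} B j B⊆Bⱼ∷A
    H-meet : SpanIsMeet H A B
    H-meet v = (λ v∈H → H⊆A v v∈H , eliminate-⊆span B j β v v∈H)
             , λ (v∈A , v∈B) →
                 ∈span-∷-∩ {A = A} Bⱼ∉A H⊆A v∈A (⊆span-∷-eliminate B j β v v∈B)

  hyperplanes : (X : Mat (suc r) n) (A B : Mat r n) → RowIndep A → RowIndep B →
                A ⊆span X → B ⊆span X → AdjΔ A B ⊎ SameCode A B
  hyperplanes X A B A-indep B-indep A⊆X B⊆X with ⊆span⊎∃∉span B A
  ... | inj₁ B⊆A = inj₂ λ v → RowIndep-⊆span⇒⊇span A B B-indep B⊆A v , B⊆A v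
  hyperplanes {r = suc r} X A B A-indep B-indep A⊆X B⊆X | inj₂ (j , Bⱼ∉A) =
    inj₁ (distinct-hyperplanes-adjacent X A B A-indep B-indep A⊆X B⊆X j Bⱼ∉A)

module CodeGraphs {c ℓ : Level} (F : FiniteField c ℓ) where
  open Codes F
  open Subspaces F

  private variable
    t m n r : ℕ

  Λ̃Vertex : (t n k : ℕ) → Mat k n → Set (c ⊔ ℓ)
  Λ̃Vertex t n k X = InC t n k X × NonIsolated t n k X

  InC-∷ : {v : Vec n} {G : Mat m n} → InC t n m G → ¬ (v ∈span G) → InC t n (suc m) (v ∷ᶠ G)
  InC-∷ (G-indep , G-tcols) v∉G =
    ∷-RowIndep G-indep v∉G , λ s s-inj d d·G≈0 → G-tcols s s-inj d (d·G≈0 ∘ suc)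

  extend-to-Λ̃Vertex : r < n → (A : Mat r n) → InC t n r A →
                      Σ (Mat (suc r) n) λ X → Λ̃Vertex t n (suc r) X × A ⊆span X
  extend-to-Λ̃Vertex {r = r} r<n A A∈C with ∃-∉span A (proj₁ A∈C) r<n
  ... | v , v∉A = v ∷ᶠ A , (InC-∷ A∈C v∉A , r , ≡.refl , A , A∈C , A⊆X) , A⊆X
    where
    A⊆X : A ⊆span (v ∷ᶠ A)
    A⊆X = rows⊆span {H = A} {G = v ∷ᶠ A} (row∈span (v ∷ᶠ A) ∘ suc)

  Λ̃-path⇒Δ-path : {X Y : Mat (suc r) n} → Star (Step (Λ̃Vertex t n (suc r)) (AdjΛ t)) X Y →
                  (A B : Mat r n) → InC t n r A → InC t n r B → A ⊆span X → B ⊆span Y →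
                  Star (Step (InC t n r) AdjΔ) A B
  Λ̃-path⇒Δ-path {X = X} ε A B A∈C B∈C A⊆X B⊆Y =
    (A∈C , B∈C , hyperplanes X A B (proj₁ A∈C) (proj₁ B∈C) A⊆X B⊆Y) ◅ ε
  Λ̃-path⇒Δ-path ((_ , _ , inj₂ X≡Z) ◅ Z⇝Y) A B A∈C B∈C A⊆X B⊆Y =
    Λ̃-path⇒Δ-path Z⇝Y A B A∈C B∈C (λ v v∈A → proj₁ (X≡Z v) (A⊆X v v∈A)) B⊆Y
  Λ̃-path⇒Δ-path {X = X} (_◅_ {j = Z} (_ , _ , inj₁ (_ , 1+r′≡1+r , H , H∈C , H-meet)) Z⇝Y)
                A B A∈C B∈C A⊆X B⊆Y
    with suc-injective 1+r′≡1+r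
  ... | ≡.refl = (A∈C , H∈C , hyperplanes X A H (proj₁ A∈C) (proj₁ H∈C) A⊆X H⊆X)
               ◅ Λ̃-path⇒Δ-path Z⇝Y H B H∈C B∈C H⊆Z B⊆Y
    where
    H⊆X : H ⊆span X
    H⊆X v v∈H = proj₁ (proj₁ (H-meet v) v∈H)
    H⊆Z : H ⊆span Z
    H⊆Z v v∈H = proj₂ (proj₁ (H-meet v) v∈H)

lemma3p8 : {c ℓ : Level} (F : FiniteField c ℓ) (n k t : ℕ) →
    0 < k → k < n → t ≤ k →
    ¬ Codes.ΔConnected F t n (k ∸ 1) → ¬ Codes.ΛtildeConnected F t n k
lemma3p8 F n (suc r) t _ k<n _ ¬Δ-connected Λ̃-connected = ¬Δ-connected Δ-connected
  where
  open Codes F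
  open CodeGraphs F
  Δ-connected : ΔConnected t n r
  Δ-connected A B A∈C B∈C
    with extend-to-Λ̃Vertex (<⇒≤ k<n) A A∈C | extend-to-Λ̃Vertex (<⇒≤ k<n) B B∈C
  ... | X , X∈Λ̃ , A⊆X | Y , Y∈Λ̃ , B⊆Y =
    Λ̃-path⇒Δ-path (Λ̃-connected X Y X∈Λ̃ Y∈Λ̃) A B A∈C B∈C A⊆X B⊆Y
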